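{- Let $m=\frac{n}{10\log n}$ and let $y^{(1)},\dots,y^{(m)}$ be independent samples from the uniform distribution on $\{y\in\{0,1\}^n:\|y\|_1=n-\log n\}$. Then the set $\{y^{(1)},\dots,y^{(m)}\}$ is shattered by the class of monotone conjunctions with probability at least $1-O(n^{ -1})$.
   Context: A monotone conjunction is a function $x\mapsto\bigwedge_{i\in E}x_i$ on $\{0,1\}^n$ for some $E\subseteq[n]$. A set $Y\subseteq\{0,1\}^n$ is shattered by a class $\mathcal{H}$ if for every labeling $b:Y\to\{0,1\}$ there is $h\in\mathcal{H}$ with $h(y)=b(y)$ for all $y\in Y$. $\|y\|_1$ is the number of ones in $y$; $n/(10\log n)$ and $\log n$ are treated as integers. -}

module Defs where

open import Data.Nat using (ℕ; zero; suc; _+_)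
open import Data.Bool using (Bool; true; false; not; _∧_; _∨_; if_then_else_)
open import Data.Vec using (Vec; []; _∷_; lookup)
open import Data.Fin using (Fin)
open import Data.Product using (∃)
open import Relation.Binary.PropositionalEquality using (_≡_)

Point : ℕ → Set
Point n = Vec Bool n

weight : ∀ {n} → Point n → ℕ
weight []        = 0
weight (b ∷ v) = (if b then 1 else 0) + weight v

-- Monotone conjunction x ↦ ⋀_{i ∈ E} x_i, with E ⊆ [n] given by its
-- indicator vector.
conj : ∀ {n} → Vec Bool n → Point n → Bool
conj []        []        = true
conj (e ∷ E) (x ∷ xs) = (not e ∨ x) ∧ conj E xs

-- The set {y_1,…,y_m} (entries of the tuple ys) is shattered by monotone
-- conjunctions: every labeling of the SET (i.e. a labeling of indices that
-- agrees on equal points) is realised by some monotone conjunction.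
Shattered : ∀ {n m} → Vec (Point n) m → Set
Shattered {n} {m} ys =
  (b : Fin m → Bool) →
  (∀ i j → lookup ys i ≡ lookup ys j → b i ≡ b j) →
  ∃ λ (E : Vec Bool n) → ∀ i → conj E (lookup ys i) ≡ b i

-- A tuple of points is shattered by monotone conjunctions as soon as every point has a private
-- zero, a coordinate where it is the only point equal to 0: to realise a labelling, take the
-- conjunction of the coordinates at which all positively labelled points are 1. For tuples of points
-- with exactly ℓ zeros, a point fails to have a private zero only if its zeros lie among the
-- at most mℓ zeros of the others, which happens for at most (mℓ C ℓ) of the (n C ℓ) choices, a
-- fraction at most 10^-ℓ since n ≥ 10mℓ. A union bound over the m points and nm ≤ 4^(ℓ+1) ≤ 4·10^ℓ
-- leave at most a 4/n fraction of tuples without private zeros.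

module Submission where

open import Defs
open import Data.Bool using (Bool; true; false; not; _∧_; _∨_; if_then_else_; T; T?)
open import Data.Bool.Properties using (∧-conicalˡ; ∧-conicalʳ; ∧-zeroʳ; not-injective; T-≡)
open import Data.Empty using (⊥-elim)
open import Data.Fin using (Fin; zero; suc)
open import Data.List using (List; []; _∷_; [_]; _++_; map; length; cartesianProductWith; filterᵇ)
open import Data.List.Properties using (length-++; length-map)
open import Data.List.Membership.Propositional.Properties using (∈-map⁻)
open import Data.List.Relation.Binary.Disjoint.Propositional using (Disjoint)
open import Data.List.Relation.Unary.All as All using (All; []; _∷_)
import Data.List.Relation.Unary.All.Properties as All
import Data.List.Relation.Unary.AllPairs as AllPairs
open import Data.List.Relation.Unary.Unique.Propositional using (Unique)
import Data.List.Relation.Unary.Unique.Propositional.Properties as Unique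
open import Data.Nat
  using (ℕ; zero; suc; _+_; _*_; _∸_; _^_; _≤_; _<_; _≤′_; ≤′-refl; ≤′-step; z≤n; s≤s; NonZero; >-nonZero; >-nonZero⁻¹)
open import Data.Nat.Combinatorics using (_C_; nC1≡n; nCk+nC[k+1]≡[n+1]C[k+1]; nCk≡nC[n∸k])
open import Data.Nat.Logarithm using (⌊log₂_⌋; ⌊log₂⌋-mono-≤; ⌊log₂[2^n]⌋≡n)
open import Data.Nat.Properties
open import Data.Nat.Tactic.RingSolver using (solve-∀)
open import Data.Product using (∃; ∃-syntax; _×_; _,_)
open import Data.Vec using (Vec; []; _∷_; lookup; replicate; zipWith; tabulate)
open import Data.Vec.Properties
  using (lookup-zipWith; lookup-replicate; lookup∘tabulate; ∷-injective; ∷-injectiveʳ)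
import Data.Vec.Relation.Unary.All as VAll
open import Function using (_∘_; Equivalence)
open import Relation.Binary.PropositionalEquality
  using (_≡_; _≢_; refl; sym; trans; cong; cong₂; subst; module ≡-Reasoning)
open import Relation.Binary.PropositionalEquality.Properties using (setoid)
open import Relation.Nullary using (yes; no; contradiction)

ones : ∀ n → Point n
ones n = replicate n true

infixr 6 _∧ᵛ_
_∧ᵛ_ : ∀ {n} → Point n → Point n → Point n
_∧ᵛ_ = zipWith _∧_

⋀ : ∀ {n m} → Vec (Point n) m → Point n
⋀ {n} []       = ones n
⋀ (y ∷ ys) = y ∧ᵛ ⋀ ys

infix 4 _⊑_
_⊑_ : ∀ {n} → Point n → Point n → Set
u ⊑ v = ∀ c → lookup u c ≡ true → lookup v c ≡ true

lookup-∧ᵛ : ∀ {n} (u v : Point n) c → lookup (u ∧ᵛ v) c ≡ lookup u c ∧ lookup v c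
lookup-∧ᵛ u v c = lookup-zipWith _∧_ c u v

∧ᵛ-⊑ˡ : ∀ {n} (u v : Point n) → u ∧ᵛ v ⊑ u
∧ᵛ-⊑ˡ u v c p = ∧-conicalˡ _ _ (trans (sym (lookup-∧ᵛ u v c)) p)

∧ᵛ-⊑ʳ : ∀ {n} (u v : Point n) → u ∧ᵛ v ⊑ v
∧ᵛ-⊑ʳ u v c p = ∧-conicalʳ _ _ (trans (sym (lookup-∧ᵛ u v c)) p)

⋀-⊑ : ∀ {n m} (ys : Vec (Point n) m) j → ⋀ ys ⊑ lookup ys j
⋀-⊑ (y ∷ ys) zero    = ∧ᵛ-⊑ˡ y (⋀ ys)
⋀-⊑ (y ∷ ys) (suc j) c p = ⋀-⊑ ys j c (∧ᵛ-⊑ʳ y (⋀ ys) c p)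

⋀-greatest : ∀ {n m} (ys : Vec (Point n) m) c →
             (∀ j → lookup (lookup ys j) c ≡ true) → lookup (⋀ ys) c ≡ true
⋀-greatest []       c _ = lookup-replicate c true
⋀-greatest (y ∷ ys) c p rewrite lookup-∧ᵛ y (⋀ ys) c | p zero
  = ⋀-greatest ys c (λ j → p (suc j))

⊑⇒conj≡true : ∀ {n} (E x : Point n) → E ⊑ x → conj E x ≡ true
⊑⇒conj≡true []          []       _   = refl
⊑⇒conj≡true (false ∷ E) (x ∷ xs) E⊑x = ⊑⇒conj≡true E xs (λ c → E⊑x (suc c))
⊑⇒conj≡true (true ∷ E)  (x ∷ xs) E⊑x rewrite E⊑x zero refl = ⊑⇒conj≡true E xs (λ c → E⊑x (suc c))

conj≡false : ∀ {n} (E x : Point n) c → lookup E c ≡ true → lookup x c ≡ false → conj E x ≡ false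
conj≡false (true ∷ E) (false ∷ xs) zero    _ _ = refl
conj≡false (e ∷ E)    (x ∷ xs)     (suc c) p q rewrite conj≡false E xs c p q = ∧-zeroʳ (not e ∨ x)

conj≡false⇒∃ : ∀ {n} (E x : Point n) → conj E x ≡ false → ∃ λ c → lookup E c ≡ true × lookup x c ≡ false
conj≡false⇒∃ []          []           ()
conj≡false⇒∃ (true ∷ E)  (false ∷ xs) _ = zero , refl , refl
conj≡false⇒∃ (true ∷ E)  (true ∷ xs)  p with conj≡false⇒∃ E xs p
... | c , Ec , xc = suc c , Ec , xc
conj≡false⇒∃ (false ∷ E) (x ∷ xs)     p with conj≡false⇒∃ E xs p
... | c , Ec , xc = suc c , Ec , xc

IsPrivateZero : ∀ {n m} → Vec (Point n) m → Fin m → Fin n → Set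
IsPrivateZero ys i c = lookup (lookup ys i) c ≡ false × (∀ j → j ≢ i → lookup (lookup ys j) c ≡ true)

-- Every point of ys has a private zero inside the support of a; the check peels off one point at a
-- time, the shape the counting argument inducts on.
hasPrivateZeros : ∀ {n m} → Point n → Vec (Point n) m → Bool
hasPrivateZeros a []       = true
hasPrivateZeros a (y ∷ ys) = not (conj (a ∧ᵛ ⋀ ys) y) ∧ hasPrivateZeros (a ∧ᵛ y) ys

privateZero : ∀ {n m} (a : Point n) (ys : Vec (Point n) m) → hasPrivateZeros a ys ≡ true →
              ∀ i → ∃ λ c → lookup a c ≡ true × IsPrivateZero ys i c
privateZero a (y ∷ ys) h zero with conj≡false⇒∃ (a ∧ᵛ ⋀ ys) y (not-injective (∧-conicalˡ _ _ h))
... | c , Ec , yc = c , ∧ᵛ-⊑ˡ a (⋀ ys) c Ec , yc , others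
  where
  others : ∀ j → j ≢ zero → lookup (lookup (y ∷ ys) j) c ≡ true
  others zero    j≢0 = ⊥-elim (j≢0 refl)
  others (suc j) _   = ⋀-⊑ ys j c (∧ᵛ-⊑ʳ a (⋀ ys) c Ec)
privateZero a (y ∷ ys) h (suc i) with privateZero (a ∧ᵛ y) ys (∧-conicalʳ _ _ h) i
... | c , ayc , yic , rest = c , ∧ᵛ-⊑ˡ a y c ayc , yic , others
  where
  others : ∀ j → j ≢ suc i → lookup (lookup (y ∷ ys) j) c ≡ true
  others zero    _     = ∧ᵛ-⊑ʳ a y c ayc
  others (suc j) j≢1+i = rest j (j≢1+i ∘ cong suc)

privateZeros⇒shattered : ∀ {n m} (ys : Vec (Point n) m) → (∀ i → ∃ (IsPrivateZero ys i)) → Shattered ys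
privateZeros⇒shattered {n} ys private-zero b _ = E , conjE
  where
  selected : Vec (Point n) _
  selected = tabulate λ j → if b j then lookup ys j else ones n

  E : Point n
  E = ⋀ selected

  selected-true : ∀ j → b j ≡ true → lookup selected j ≡ lookup ys j
  selected-true j bj rewrite lookup∘tabulate (λ j → if b j then lookup ys j else ones n) j | bj = refl

  selected-at : ∀ c j → (b j ≡ true → lookup (lookup ys j) c ≡ true) → lookup (lookup selected j) c ≡ true
  selected-at c j p rewrite lookup∘tabulate (λ j → if b j then lookup ys j else ones n) j with b j
  ... | true  = p refl
  ... | false = lookup-replicate c true

  conjE : ∀ i → conj E (lookup ys i) ≡ b i
  conjE i with b i in bi
  ... | true  = ⊑⇒conj≡true E (lookup ys i) (subst (E ⊑_) (selected-true i bi) (⋀-⊑ selected i))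
  ... | false with private-zero i
  ... | c , yᵢ[c]≡false , others≡true =
    conj≡false E (lookup ys i) c (⋀-greatest selected c E[c]≡true) yᵢ[c]≡false
    where
    E[c]≡true : ∀ j → lookup (lookup selected j) c ≡ true
    E[c]≡true j = selected-at c j λ bj → others≡true j λ { refl → contradiction (trans (sym bj) bi) λ () }

private
  variable
    A B : Set

𝟙 : Bool → ℕ
𝟙 true  = 1
𝟙 false = 0

𝟙-not-∧-≤ : ∀ p q → 𝟙 (not (not p ∧ q)) ≤ 𝟙 p + 𝟙 (not q)
𝟙-not-∧-≤ true  q     = s≤s z≤n
𝟙-not-∧-≤ false true  = z≤n
𝟙-not-∧-≤ false false = s≤s z≤n

∑ : List A → (A → ℕ) → ℕ
∑ []       f = 0
∑ (x ∷ xs) f = f x + ∑ xs f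

syntax ∑ xs (λ x → e) = ∑[ x ∈ xs ] e

∑-++ : ∀ (xs ys : List A) f → ∑ (xs ++ ys) f ≡ ∑ xs f + ∑ ys f
∑-++ []       ys f = refl
∑-++ (x ∷ xs) ys f = trans (cong (f x +_) (∑-++ xs ys f)) (sym (+-assoc (f x) _ _))

∑-map : ∀ (g : B → A) (xs : List B) f → ∑ (map g xs) f ≡ ∑[ x ∈ xs ] f (g x)
∑-map g []       f = refl
∑-map g (x ∷ xs) f = cong (f (g x) +_) (∑-map g xs f)

∑-cong : ∀ (xs : List A) {f g} → (∀ x → f x ≡ g x) → ∑ xs f ≡ ∑ xs g
∑-cong []       f≗g = refl
∑-cong (x ∷ xs) f≗g = cong₂ _+_ (f≗g x) (∑-cong xs f≗g)

∑-mono-≤ : ∀ {xs : List A} {f g} → All (λ x → f x ≤ g x) xs → ∑ xs f ≤ ∑ xs g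
∑-mono-≤ []         = z≤n
∑-mono-≤ (px ∷ pxs) = +-mono-≤ px (∑-mono-≤ pxs)

∑-const : ∀ (xs : List A) c → ∑[ _ ∈ xs ] c ≡ length xs * c
∑-const []       c = refl
∑-const (x ∷ xs) c = cong (c +_) (∑-const xs c)

∑-distrib-+ : ∀ (xs : List A) f g → ∑[ x ∈ xs ] (f x + g x) ≡ ∑ xs f + ∑ xs g
∑-distrib-+ []       f g = refl
∑-distrib-+ (x ∷ xs) f g = trans (cong (f x + g x +_) (∑-distrib-+ xs f g)) (+-exchange (f x) (g x) _ _)
  where
  +-exchange : ∀ a b c d → a + b + (c + d) ≡ a + c + (b + d)
  +-exchange = solve-∀

∑-distribʳ-* : ∀ (xs : List A) f c → ∑[ x ∈ xs ] (f x * c) ≡ ∑ xs f * c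
∑-distribʳ-* []       f c = refl
∑-distribʳ-* (x ∷ xs) f c = trans (cong (f x * c +_) (∑-distribʳ-* xs f c)) (sym (*-distribʳ-+ c (f x) _))

∑-comm : ∀ (xs : List A) (ys : List B) (h : A → B → ℕ) →
         ∑[ x ∈ xs ] ∑[ y ∈ ys ] h x y ≡ ∑[ y ∈ ys ] ∑[ x ∈ xs ] h x y
∑-comm []       ys h = sym (trans (∑-const ys 0) (*-zeroʳ (length ys)))
∑-comm (x ∷ xs) ys h = trans (cong (∑[ y ∈ ys ] h x y +_) (∑-comm xs ys h))
                             (sym (∑-distrib-+ ys (h x) (λ y → ∑[ x ∈ xs ] h x y)))

length-filterᵇ+∑-rejected : ∀ (p : A → Bool) xs → length (filterᵇ p xs) + ∑[ x ∈ xs ] 𝟙 (not (p x)) ≡ length xs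
length-filterᵇ+∑-rejected p []       = refl
length-filterᵇ+∑-rejected p (x ∷ xs) with p x
... | true  = cong suc (length-filterᵇ+∑-rejected p xs)
... | false = trans (+-suc _ _) (cong suc (length-filterᵇ+∑-rejected p xs))

length-cartesianProductWith : ∀ {C : Set} (f : A → B → C) xs ys →
                              length (cartesianProductWith f xs ys) ≡ length xs * length ys
length-cartesianProductWith f []       ys = refl
length-cartesianProductWith f (x ∷ xs) ys =
  trans (length-++ (map (f x) ys)) (cong₂ _+_ (length-map (f x) ys) (length-cartesianProductWith f xs ys))

∑-cartesianProductWith : ∀ {C : Set} (f : A → B → C) xs ys g →
                         ∑ (cartesianProductWith f xs ys) g ≡ ∑[ x ∈ xs ] ∑[ y ∈ ys ] g (f x y)
∑-cartesianProductWith f []       ys g = refl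
∑-cartesianProductWith f (x ∷ xs) ys g = trans (∑-++ (map (f x) ys) _ g)
  (cong₂ _+_ (∑-map (f x) ys g) (∑-cartesianProductWith f xs ys g))

tuples : List A → ∀ m → List (Vec A m)
tuples xs zero    = [ [] ]
tuples xs (suc m) = cartesianProductWith _∷_ xs (tuples xs m)

length-tuples : ∀ (xs : List A) m → length (tuples xs m) ≡ length xs ^ m
length-tuples xs zero    = refl
length-tuples xs (suc m) =
  trans (length-cartesianProductWith _∷_ xs (tuples xs m)) (cong (length xs *_) (length-tuples xs m))

tuples-unique : ∀ {xs : List A} → Unique xs → ∀ m → Unique (tuples xs m)
tuples-unique xs! zero    = [] AllPairs.∷ AllPairs.[]
tuples-unique xs! (suc m) = Unique.cartesianProductWith⁺ _∷_ ∷-injective xs! (tuples-unique xs! m)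

tuples-all : ∀ {P : A → Set} {xs} → All P xs → ∀ m → All (VAll.All P) (tuples xs m)
tuples-all         Pxs zero    = VAll.[] ∷ []
tuples-all {A = A} {xs = xs} Pxs (suc m) =
  All.cartesianProductWith⁺ (setoid A) (setoid (Vec A m)) _∷_ xs (tuples xs m)
    λ x∈xs t∈ → All.lookup Pxs x∈xs VAll.∷ All.lookup (tuples-all Pxs m) t∈

pascal : ∀ n k → suc n C suc k ≡ n C k + n C suc k
pascal n k = sym (nCk+nC[k+1]≡[n+1]C[k+1] n k)

nCk≤[1+n]Ck : ∀ n k → n C k ≤ suc n C k
nCk≤[1+n]Ck n zero    = ≤-refl
nCk≤[1+n]Ck n (suc k) = subst (n C suc k ≤_) (sym (pascal n k)) (m≤n+m (n C suc k) (n C k))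

C-monoˡ-≤ : ∀ k {m n} → m ≤ n → m C k ≤ n C k
C-monoˡ-≤ k m≤n = go (≤⇒≤′ m≤n)
  where
  go : ∀ {m n} → m ≤′ n → m C k ≤ n C k
  go ≤′-refl        = ≤-refl
  go (≤′-step m≤′n) = ≤-trans (go m≤′n) (nCk≤[1+n]Ck _ k)

k≤n⇒0<nCk : ∀ {n k} → k ≤ n → 0 < n C k
k≤n⇒0<nCk {k = zero}  _         = s≤s z≤n
k≤n⇒0<nCk {suc n} {suc k} (s≤s k≤n) =
  subst (0 <_) (sym (pascal n k)) (≤-trans (k≤n⇒0<nCk k≤n) (m≤m+n (n C k) (n C suc k)))

[1+n]C[1+k]*[1+k]≡[1+n]*nCk : ∀ n k → (suc n C suc k) * suc k ≡ suc n * (n C k)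
[1+n]C[1+k]*[1+k]≡[1+n]*nCk n       zero    =
  trans (*-identityʳ (suc n C 1)) (trans (nC1≡n (suc n)) (sym (*-identityʳ (suc n))))
[1+n]C[1+k]*[1+k]≡[1+n]*nCk zero    (suc k) = refl
[1+n]C[1+k]*[1+k]≡[1+n]*nCk (suc n) (suc k) = begin
  (suc (suc n) C suc (suc k)) * suc (suc k)
    ≡⟨ cong (_* suc (suc k)) (pascal (suc n) (suc k)) ⟩
  (a + b) * suc (suc k)
    ≡⟨ expand a b k ⟩
  a * suc k + a + b * suc (suc k)
    ≡⟨ cong₂ (λ x y → x + a + y) ([1+n]C[1+k]*[1+k]≡[1+n]*nCk n k) ([1+n]C[1+k]*[1+k]≡[1+n]*nCk n (suc k)) ⟩
  suc n * (n C k) + a + suc n * (n C suc k)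
    ≡⟨ cong (λ x → suc n * (n C k) + x + suc n * (n C suc k)) (pascal n k) ⟩
  suc n * (n C k) + ((n C k) + (n C suc k)) + suc n * (n C suc k)
    ≡⟨ collect n (n C k) (n C suc k) ⟩
  suc (suc n) * ((n C k) + (n C suc k))
    ≡⟨ cong (suc (suc n) *_) (sym (pascal n k)) ⟩
  suc (suc n) * (suc n C suc k) ∎
  where
  open ≡-Reasoning
  a = suc n C suc k
  b = suc n C suc (suc k)
  expand : ∀ a b k → (a + b) * suc (suc k) ≡ a * suc k + a + b * suc (suc k)
  expand = solve-∀
  collect : ∀ n a b → suc n * a + (a + b) + suc n * b ≡ suc (suc n) * (a + b)
  collect = solve-∀

b^k*sCk≤nCk : ∀ b .{{_ : NonZero b}} k {s n} → b * s ≤ n → b ^ k * (s C k) ≤ n C k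
b^k*sCk≤nCk b zero    _ = ≤-refl
b^k*sCk≤nCk b (suc k) {zero}  _ = ≤-trans (≤-reflexive (*-zeroʳ (b ^ suc k))) z≤n
b^k*sCk≤nCk b (suc k) {suc s} {zero} bs≤0 = contradiction (≤-trans (m≤n*m (suc s) b) bs≤0) λ ()
b^k*sCk≤nCk b (suc k) {suc s} {suc n} b[1+s]≤1+n = *-cancelʳ-≤ _ _ (suc k) (begin
  b ^ suc k * (suc s C suc k) * suc k     ≡⟨ *-assoc (b ^ suc k) (suc s C suc k) (suc k) ⟩
  b ^ suc k * ((suc s C suc k) * suc k)   ≡⟨ cong (b ^ suc k *_) ([1+n]C[1+k]*[1+k]≡[1+n]*nCk s k) ⟩
  b ^ suc k * (suc s * (s C k))           ≡⟨ regroup b (b ^ k) (suc s) (s C k) ⟩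
  b * suc s * (b ^ k * (s C k))           ≤⟨ *-mono-≤ b[1+s]≤1+n (b^k*sCk≤nCk b k bs≤n) ⟩
  suc n * (n C k)                         ≡⟨ sym ([1+n]C[1+k]*[1+k]≡[1+n]*nCk n k) ⟩
  (suc n C suc k) * suc k                 ∎)
  where
  open ≤-Reasoning
  regroup : ∀ b p s c → b * p * (s * c) ≡ b * s * (p * c)
  regroup = solve-∀
  bs≤n : b * s ≤ n
  bs≤n = ≤-pred (≤-trans (+-monoˡ-≤ (b * s) (>-nonZero⁻¹ b))
                         (≤-trans (≤-reflexive (sym (*-suc b s))) b[1+s]≤1+n))

n<2^n : ∀ n → n < 2 ^ n
n<2^n zero    = s≤s z≤n
n<2^n (suc n) = begin-strict
  suc n             ≡⟨ +-comm 1 n ⟩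
  n + 1             <⟨ +-mono-<-≤ (n<2^n n) (m^n>0 2 n) ⟩
  2 ^ n + 2 ^ n     ≡⟨ cong (2 ^ n +_) (sym (+-identityʳ (2 ^ n))) ⟩
  2 ^ suc n         ∎
  where open ≤-Reasoning

⌊log₂n⌋≤n : ∀ n → ⌊log₂ n ⌋ ≤ n
⌊log₂n⌋≤n n = subst (⌊log₂ n ⌋ ≤_) (⌊log₂[2^n]⌋≡n n) (⌊log₂⌋-mono-≤ (<⇒≤ (n<2^n n)))

n<2^[1+⌊log₂n⌋] : ∀ n → n < 2 ^ suc ⌊log₂ n ⌋
n<2^[1+⌊log₂n⌋] n with 2 ^ suc ⌊log₂ n ⌋ ≤? n
... | no  2^≰n = ≰⇒> 2^≰n
... | yes 2^≤n = contradiction (subst (_≤ ⌊log₂ n ⌋) (⌊log₂[2^n]⌋≡n _) (⌊log₂⌋-mono-≤ 2^≤n)) (n≮n _)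

2^[1+k]*2^[1+k]≤4*10^k : ∀ k → 2 ^ suc k * 2 ^ suc k ≤ 4 * 10 ^ k
2^[1+k]*2^[1+k]≤4*10^k zero    = ≤-refl
2^[1+k]*2^[1+k]≤4*10^k (suc k) = begin
  2 ^ suc (suc k) * 2 ^ suc (suc k) ≡⟨ square-double (2 ^ suc k) ⟩
  4 * (2 ^ suc k * 2 ^ suc k)       ≤⟨ *-mono-≤ (m≤m+n 4 6) (2^[1+k]*2^[1+k]≤4*10^k k) ⟩
  10 * (4 * 10 ^ k)                 ≡⟨ swap-outer 10 4 (10 ^ k) ⟩
  4 * 10 ^ suc k                    ∎
  where
  open ≤-Reasoning
  square-double : ∀ x → (2 * x) * (2 * x) ≡ 4 * (x * x)
  square-double = solve-∀
  swap-outer : ∀ a b c → a * (b * c) ≡ b * (a * c)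
  swap-outer = solve-∀

zeros : ∀ {n} → Point n → ℕ
zeros []      = 0
zeros (b ∷ v) = (if b then 0 else 1) + zeros v

weight+zeros≡n : ∀ {n} (y : Point n) → weight y + zeros y ≡ n
weight+zeros≡n []          = refl
weight+zeros≡n (true ∷ y)  = cong suc (weight+zeros≡n y)
weight+zeros≡n (false ∷ y) = trans (+-suc (weight y) (zeros y)) (cong suc (weight+zeros≡n y))

zeros-ones : ∀ n → zeros (ones n) ≡ 0
zeros-ones zero    = refl
zeros-ones (suc n) = zeros-ones n

zeros-∧ᵛ : ∀ {n} (u v : Point n) → zeros (u ∧ᵛ v) ≤ zeros u + zeros v
zeros-∧ᵛ []          []          = z≤n
zeros-∧ᵛ (true ∷ u)  (true ∷ v)  = zeros-∧ᵛ u v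
zeros-∧ᵛ (true ∷ u)  (false ∷ v) = ≤-trans (s≤s (zeros-∧ᵛ u v)) (≤-reflexive (sym (+-suc (zeros u) (zeros v))))
zeros-∧ᵛ (false ∷ u) (b ∷ v)     = s≤s (≤-trans (zeros-∧ᵛ u v) (+-monoʳ-≤ (zeros u) (m≤n+m (zeros v) _)))

zeros-⋀ : ∀ {n m ℓ} (ys : Vec (Point n) m) → VAll.All (λ y → zeros y ≤ ℓ) ys → zeros (⋀ ys) ≤ m * ℓ
zeros-⋀ {n} []       _                = ≤-reflexive (zeros-ones n)
zeros-⋀     (y ∷ ys) (y≤ℓ VAll.∷ ys≤ℓ) = ≤-trans (zeros-∧ᵛ y (⋀ ys)) (+-mono-≤ y≤ℓ (zeros-⋀ ys ys≤ℓ))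

pointsWithZeros : (n k : ℕ) → List (Point n)
pointsWithZeros zero    zero    = [ [] ]
pointsWithZeros zero    (suc k) = []
pointsWithZeros (suc n) zero    = map (true ∷_) (pointsWithZeros n zero)
pointsWithZeros (suc n) (suc k) = map (true ∷_) (pointsWithZeros n (suc k)) ++ map (false ∷_) (pointsWithZeros n k)

length-pointsWithZeros : ∀ n k → length (pointsWithZeros n k) ≡ n C k
length-pointsWithZeros zero    zero    = refl
length-pointsWithZeros zero    (suc k) = refl
length-pointsWithZeros (suc n) zero    = trans (length-map _ (pointsWithZeros n zero)) (length-pointsWithZeros n zero)
length-pointsWithZeros (suc n) (suc k) = begin
  length (map (true ∷_) (pointsWithZeros n (suc k)) ++ map (false ∷_) (pointsWithZeros n k))
    ≡⟨ length-++ (map (true ∷_) (pointsWithZeros n (suc k))) ⟩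
  length (map (true ∷_) (pointsWithZeros n (suc k))) + length (map (false ∷_) (pointsWithZeros n k))
    ≡⟨ cong₂ _+_ (length-map _ (pointsWithZeros n (suc k))) (length-map _ (pointsWithZeros n k)) ⟩
  length (pointsWithZeros n (suc k)) + length (pointsWithZeros n k)
    ≡⟨ cong₂ _+_ (length-pointsWithZeros n (suc k)) (length-pointsWithZeros n k) ⟩
  n C suc k + n C k
    ≡⟨ trans (+-comm (n C suc k) (n C k)) (sym (pascal n k)) ⟩
  suc n C suc k ∎
  where open ≡-Reasoning

pointsWithZeros-zeros : ∀ n k → All (λ y → zeros y ≡ k) (pointsWithZeros n k)
pointsWithZeros-zeros zero    zero    = refl ∷ []
pointsWithZeros-zeros zero    (suc k) = []
pointsWithZeros-zeros (suc n) zero    = All.map⁺ (pointsWithZeros-zeros n zero)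
pointsWithZeros-zeros (suc n) (suc k) =
  All.++⁺ (All.map⁺ (pointsWithZeros-zeros n (suc k))) (All.map⁺ (All.map (cong suc) (pointsWithZeros-zeros n k)))

pointsWithZeros-unique : ∀ n k → Unique (pointsWithZeros n k)
pointsWithZeros-unique zero    zero    = [] AllPairs.∷ AllPairs.[]
pointsWithZeros-unique zero    (suc k) = AllPairs.[]
pointsWithZeros-unique (suc n) zero    = Unique.map⁺ ∷-injectiveʳ (pointsWithZeros-unique n zero)
pointsWithZeros-unique (suc n) (suc k) = Unique.++⁺
  (Unique.map⁺ ∷-injectiveʳ (pointsWithZeros-unique n (suc k)))
  (Unique.map⁺ ∷-injectiveʳ (pointsWithZeros-unique n k))
  heads-differ
  where
  heads-differ : Disjoint (map (true ∷_) (pointsWithZeros n (suc k))) (map (false ∷_) (pointsWithZeros n k))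
  heads-differ (p , q) with ∈-map⁻ (true ∷_) p | ∈-map⁻ (false ∷_) q
  ... | _ , _ , refl | _ , _ , ()

count-conj-pointsWithZeros : ∀ n k (u : Point n) → ∑[ y ∈ pointsWithZeros n k ] 𝟙 (conj u y) ≡ zeros u C k
count-conj-pointsWithZeros zero    zero    []      = refl
count-conj-pointsWithZeros zero    (suc k) []      = refl
count-conj-pointsWithZeros (suc n) zero    (true ∷ u)  =
  trans (∑-map _ (pointsWithZeros n zero) _) (count-conj-pointsWithZeros n zero u)
count-conj-pointsWithZeros (suc n) zero    (false ∷ u) =
  trans (∑-map _ (pointsWithZeros n zero) _) (count-conj-pointsWithZeros n zero u)
count-conj-pointsWithZeros (suc n) (suc k) (e ∷ u)     = begin
  ∑ (map (true ∷_) Wₖ₊₁ ++ map (false ∷_) Wₖ) f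
    ≡⟨ ∑-++ (map (true ∷_) Wₖ₊₁) _ f ⟩
  ∑ (map (true ∷_) Wₖ₊₁) f + ∑ (map (false ∷_) Wₖ) f
    ≡⟨ cong₂ _+_ (∑-map _ Wₖ₊₁ f) (∑-map _ Wₖ f) ⟩
  ∑[ y ∈ Wₖ₊₁ ] f (true ∷ y) + ∑[ y ∈ Wₖ ] f (false ∷ y)
    ≡⟨ split e ⟩
  zeros (e ∷ u) C suc k ∎
  where
  open ≡-Reasoning
  Wₖ₊₁ = pointsWithZeros n (suc k)
  Wₖ   = pointsWithZeros n k
  f : Point (suc n) → ℕ
  f y = 𝟙 (conj (e ∷ u) y)
  split : ∀ e → ∑[ y ∈ Wₖ₊₁ ] 𝟙 (conj (e ∷ u) (true ∷ y)) + ∑[ y ∈ Wₖ ] 𝟙 (conj (e ∷ u) (false ∷ y))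
                ≡ zeros (e ∷ u) C suc k
  split true  = trans (cong₂ _+_ (count-conj-pointsWithZeros n (suc k) u) (trans (∑-const Wₖ 0) (*-zeroʳ (length Wₖ))))
                      (+-identityʳ _)
  split false = trans (cong₂ _+_ (count-conj-pointsWithZeros n (suc k) u) (count-conj-pointsWithZeros n k u))
                      (trans (+-comm (zeros u C suc k) (zeros u C k)) (sym (pascal (zeros u) k)))

module _ {n : ℕ} (ℓ : ℕ) where

  private
    W = pointsWithZeros n ℓ

  #withoutPrivateZeros : ℕ → Point n → ℕ
  #withoutPrivateZeros m a = ∑[ ys ∈ tuples W m ] 𝟙 (not (hasPrivateZeros a ys))

  pointsWithZeros-zeros≤ : All (λ y → zeros y ≤ ℓ) W
  pointsWithZeros-zeros≤ = All.map ≤-reflexive (pointsWithZeros-zeros n ℓ)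

  length-tuples-pointsWithZeros : ∀ m → length (tuples W m) ≡ (n C ℓ) ^ m
  length-tuples-pointsWithZeros m = trans (length-tuples W m) (cong (_^ m) (length-pointsWithZeros n ℓ))

  #first-point-covered : ∀ T m (a : Point n) → zeros a + m * ℓ ≤ T →
    ∑[ y ∈ W ] ∑[ ys ∈ tuples W m ] 𝟙 (conj (a ∧ᵛ ⋀ ys) y) ≤ (n C ℓ) ^ m * (T C ℓ)
  #first-point-covered T m a za+mℓ≤T = begin
    ∑[ y ∈ W ] ∑[ ys ∈ tuples W m ] 𝟙 (conj (a ∧ᵛ ⋀ ys) y)
      ≡⟨ ∑-comm W (tuples W m) _ ⟩
    ∑[ ys ∈ tuples W m ] ∑[ y ∈ W ] 𝟙 (conj (a ∧ᵛ ⋀ ys) y)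
      ≡⟨ ∑-cong (tuples W m) (λ ys → count-conj-pointsWithZeros n ℓ (a ∧ᵛ ⋀ ys)) ⟩
    ∑[ ys ∈ tuples W m ] (zeros (a ∧ᵛ ⋀ ys) C ℓ)
      ≤⟨ ∑-mono-≤ (All.map (C-monoˡ-≤ ℓ ∘ zeros≤T) (tuples-all pointsWithZeros-zeros≤ m)) ⟩
    ∑[ _ ∈ tuples W m ] (T C ℓ)
      ≡⟨ ∑-const (tuples W m) (T C ℓ) ⟩
    length (tuples W m) * (T C ℓ)
      ≡⟨ cong (_* (T C ℓ)) (length-tuples-pointsWithZeros m) ⟩
    (n C ℓ) ^ m * (T C ℓ) ∎
    where
    open ≤-Reasoning
    zeros≤T : ∀ {ys} → VAll.All (λ y → zeros y ≤ ℓ) ys → zeros (a ∧ᵛ ⋀ ys) ≤ T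
    zeros≤T {ys} ys≤ℓ = ≤-trans (zeros-∧ᵛ a (⋀ ys)) (≤-trans (+-monoʳ-≤ (zeros a) (zeros-⋀ ys ys≤ℓ)) za+mℓ≤T)

  #withoutPrivateZeros-bound : ∀ T m (a : Point n) → zeros a + m * ℓ ≤ T →
    #withoutPrivateZeros m a * (n C ℓ) ≤ m * ((n C ℓ) ^ m * (T C ℓ))
  #withoutPrivateZeros-bound T zero    a _             = z≤n
  #withoutPrivateZeros-bound T (suc m) a za+[1+m]ℓ≤T = begin
    #withoutPrivateZeros (suc m) a * c
      ≡⟨ cong (_* c) (∑-cartesianProductWith _∷_ W (tuples W m) _) ⟩
    (∑[ y ∈ W ] ∑[ ys ∈ tuples W m ] 𝟙 (not (hasPrivateZeros a (y ∷ ys)))) * c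
      ≤⟨ *-monoˡ-≤ c (∑-mono-≤ (All.universal split W)) ⟩
    (∑[ y ∈ W ] (covered y + #withoutPrivateZeros m (a ∧ᵛ y))) * c
      ≡⟨ cong (_* c) (∑-distrib-+ W covered (λ y → #withoutPrivateZeros m (a ∧ᵛ y))) ⟩
    (∑ W covered + ∑[ y ∈ W ] #withoutPrivateZeros m (a ∧ᵛ y)) * c
      ≡⟨ *-distribʳ-+ c (∑ W covered) _ ⟩
    ∑ W covered * c + (∑[ y ∈ W ] #withoutPrivateZeros m (a ∧ᵛ y)) * c
      ≤⟨ +-mono-≤ (*-monoˡ-≤ c (#first-point-covered T m a za+mℓ≤T)) later-points ⟩
    c ^ m * b * c + c * (m * (c ^ m * b))
      ≡⟨ collect c (c ^ m) b m ⟩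
    suc m * (c ^ suc m * b) ∎
    where
    open ≤-Reasoning
    c = n C ℓ
    b = T C ℓ

    covered : Point n → ℕ
    covered y = ∑[ ys ∈ tuples W m ] 𝟙 (conj (a ∧ᵛ ⋀ ys) y)

    split : ∀ y → ∑[ ys ∈ tuples W m ] 𝟙 (not (hasPrivateZeros a (y ∷ ys)))
                  ≤ covered y + #withoutPrivateZeros m (a ∧ᵛ y)
    split y = ≤-trans
      (∑-mono-≤ (All.universal (λ ys → 𝟙-not-∧-≤ (conj (a ∧ᵛ ⋀ ys) y) (hasPrivateZeros (a ∧ᵛ y) ys)) (tuples W m)))
      (≤-reflexive (∑-distrib-+ (tuples W m) _ _))

    za+mℓ≤T : zeros a + m * ℓ ≤ T
    za+mℓ≤T = ≤-trans (+-monoʳ-≤ (zeros a) (m≤n+m (m * ℓ) ℓ)) za+[1+m]ℓ≤T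

    za∧y+mℓ≤T : ∀ {y} → zeros y ≤ ℓ → zeros (a ∧ᵛ y) + m * ℓ ≤ T
    za∧y+mℓ≤T {y} y≤ℓ = begin
      zeros (a ∧ᵛ y) + m * ℓ    ≤⟨ +-monoˡ-≤ (m * ℓ) (≤-trans (zeros-∧ᵛ a y) (+-monoʳ-≤ (zeros a) y≤ℓ)) ⟩
      zeros a + ℓ + m * ℓ       ≡⟨ +-assoc (zeros a) ℓ (m * ℓ) ⟩
      zeros a + suc m * ℓ       ≤⟨ za+[1+m]ℓ≤T ⟩
      T                         ∎

    later-points : (∑[ y ∈ W ] #withoutPrivateZeros m (a ∧ᵛ y)) * c ≤ c * (m * (c ^ m * b))
    later-points = begin
      (∑[ y ∈ W ] #withoutPrivateZeros m (a ∧ᵛ y)) * c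
        ≡⟨ ∑-distribʳ-* W _ c ⟨
      ∑[ y ∈ W ] (#withoutPrivateZeros m (a ∧ᵛ y) * c)
        ≤⟨ ∑-mono-≤ (All.map (#withoutPrivateZeros-bound T m _ ∘ za∧y+mℓ≤T) pointsWithZeros-zeros≤) ⟩
      ∑[ _ ∈ W ] (m * (c ^ m * b))
        ≡⟨ ∑-const W _ ⟩
      length W * (m * (c ^ m * b))
        ≡⟨ cong (_* (m * (c ^ m * b))) (length-pointsWithZeros n ℓ) ⟩
      c * (m * (c ^ m * b)) ∎

    collect : ∀ c x b m → x * b * c + c * (m * (x * b)) ≡ suc m * (c * x * b)
    collect = solve-∀

few-tuples-lack-private-zeros : ∀ n ℓ m .{{_ : NonZero ℓ}} → ℓ ≡ ⌊log₂ n ⌋ → 10 * ℓ * m ≤ n →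
  n * #withoutPrivateZeros {n} ℓ m (ones n) ≤ 4 * (n C ℓ) ^ m
few-tuples-lack-private-zeros n ℓ m ℓ≡log 10ℓm≤n = *-cancelʳ-≤ _ _ c {{>-nonZero c>0}} (begin
  n * bad * c                 ≡⟨ *-assoc n bad c ⟩
  n * (bad * c)               ≤⟨ *-monoʳ-≤ n bad*c≤ ⟩
  n * (m * (c ^ m * b))       ≡⟨ regroup n m (c ^ m) b ⟩
  c ^ m * ((n * m) * b)       ≤⟨ *-monoʳ-≤ (c ^ m) (*-monoˡ-≤ b nm≤4*10^ℓ) ⟩
  c ^ m * (4 * 10 ^ ℓ * b)    ≡⟨ cong (c ^ m *_) (*-assoc 4 (10 ^ ℓ) b) ⟩
  c ^ m * (4 * (10 ^ ℓ * b))  ≤⟨ *-monoʳ-≤ (c ^ m) (*-monoʳ-≤ 4 10^ℓ*b≤c) ⟩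
  c ^ m * (4 * c)             ≡⟨ regroup′ (c ^ m) c ⟩
  4 * c ^ m * c               ∎)
  where
  open ≤-Reasoning
  c = n C ℓ
  b = (m * ℓ) C ℓ
  bad = #withoutPrivateZeros {n} ℓ m (ones n)

  rearrange : ∀ ℓ m → 10 * (m * ℓ) ≡ 10 * ℓ * m
  rearrange = solve-∀
  regroup : ∀ n m x b → n * (m * (x * b)) ≡ x * ((n * m) * b)
  regroup = solve-∀
  regroup′ : ∀ x c → x * (4 * c) ≡ 4 * x * c
  regroup′ = solve-∀

  ℓ≤n : ℓ ≤ n
  ℓ≤n = subst (_≤ n) (sym ℓ≡log) (⌊log₂n⌋≤n n)

  c>0 : 0 < c
  c>0 = k≤n⇒0<nCk ℓ≤n

  bad*c≤ : bad * c ≤ m * (c ^ m * b)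
  bad*c≤ = #withoutPrivateZeros-bound ℓ (m * ℓ) m (ones n) (≤-reflexive (cong (_+ m * ℓ) (zeros-ones n)))

  10^ℓ*b≤c : 10 ^ ℓ * b ≤ c
  10^ℓ*b≤c = b^k*sCk≤nCk 10 ℓ (≤-trans (≤-reflexive (rearrange ℓ m)) 10ℓm≤n)

  n<2^[1+ℓ] : n < 2 ^ suc ℓ
  n<2^[1+ℓ] = subst (λ k → n < 2 ^ suc k) (sym ℓ≡log) (n<2^[1+⌊log₂n⌋] n)

  m≤n : m ≤ n
  m≤n = ≤-trans (m≤n*m m (10 * ℓ) {{m*n≢0 10 ℓ}}) 10ℓm≤n

  nm≤4*10^ℓ : n * m ≤ 4 * 10 ^ ℓ
  nm≤4*10^ℓ = ≤-trans (*-mono-≤ (<⇒≤ n<2^[1+ℓ]) (≤-trans m≤n (<⇒≤ n<2^[1+ℓ]))) (2^[1+k]*2^[1+k]≤4*10^k ℓ)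

tuplesWithPrivateZeros : ∀ n ℓ m → List (Vec (Point n) m)
tuplesWithPrivateZeros n ℓ m = filterᵇ (hasPrivateZeros (ones n)) (tuples (pointsWithZeros n ℓ) m)

tuplesWithPrivateZeros-unique : ∀ n ℓ m → Unique (tuplesWithPrivateZeros n ℓ m)
tuplesWithPrivateZeros-unique n ℓ m =
  Unique.filter⁺ (T? ∘ hasPrivateZeros (ones n)) (tuples-unique (pointsWithZeros-unique n ℓ) m)

zeros≡ℓ⇒weight≡n∸ℓ : ∀ {n ℓ} (y : Point n) → zeros y ≡ ℓ → weight y ≡ n ∸ ℓ
zeros≡ℓ⇒weight≡n∸ℓ {n} {ℓ} y refl = trans (sym (m+n∸n≡m (weight y) ℓ)) (cong (_∸ ℓ) (weight+zeros≡n y))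

tuplesWithPrivateZeros-shattered : ∀ n ℓ m →
  All (λ ys → VAll.All (λ y → weight y ≡ n ∸ ℓ) ys × Shattered ys) (tuplesWithPrivateZeros n ℓ m)
tuplesWithPrivateZeros-shattered n ℓ m =
  All.zipWith (λ { {ys} (weights , privateZeros) → weights , shattered ys privateZeros })
    ( All.filter⁺ (T? ∘ hasPrivateZeros (ones n)) (All.map (VAll.map λ {y} → zeros≡ℓ⇒weight≡n∸ℓ y) zeros-ℓ)
    , All.all-filter (T? ∘ hasPrivateZeros (ones n)) (tuples (pointsWithZeros n ℓ) m) )
  where
  zeros-ℓ : All (VAll.All (λ y → zeros y ≡ ℓ)) (tuples (pointsWithZeros n ℓ) m)
  zeros-ℓ = tuples-all (pointsWithZeros-zeros n ℓ) m

  shattered : ∀ ys → T (hasPrivateZeros (ones n) ys) → Shattered ys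
  shattered ys t = privateZeros⇒shattered ys λ i →
    let c , _ , isPrivate = privateZero (ones n) ys (Equivalence.to T-≡ t) i in c , isPrivate

tuplesWithPrivateZeros-many : ∀ n ℓ m .{{_ : NonZero ℓ}} → ℓ ≡ ⌊log₂ n ⌋ → 10 * ℓ * m ≤ n →
  n * ((n C (n ∸ ℓ)) ^ m) ≤ n * length (tuplesWithPrivateZeros n ℓ m) + 4 * ((n C (n ∸ ℓ)) ^ m)
tuplesWithPrivateZeros-many n ℓ m ℓ≡log 10ℓm≤n
  rewrite sym (nCk≡nC[n∸k] (subst (_≤ n) (sym ℓ≡log) (⌊log₂n⌋≤n n))) = begin
  n * (n C ℓ) ^ m                  ≡⟨ cong (n *_) partition ⟨
  n * (length good + bad)          ≡⟨ *-distribˡ-+ n (length good) bad ⟩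
  n * length good + n * bad        ≤⟨ +-monoʳ-≤ (n * length good) n*bad≤ ⟩
  n * length good + 4 * (n C ℓ) ^ m ∎
  where
  open ≤-Reasoning
  good = tuplesWithPrivateZeros n ℓ m
  bad = #withoutPrivateZeros {n} ℓ m (ones n)
  n*bad≤ : n * bad ≤ 4 * (n C ℓ) ^ m
  n*bad≤ = few-tuples-lack-private-zeros n ℓ m ℓ≡log 10ℓm≤n
  partition : length good + bad ≡ (n C ℓ) ^ m
  partition = trans (length-filterᵇ+∑-rejected (hasPrivateZeros (ones n)) (tuples (pointsWithZeros n ℓ) m))
                    (length-tuples-pointsWithZeros ℓ m)

-- The hypothesis n < 10ℓ(m+1) is only used to rule out ℓ = 0.
lemma8p4 : ∃[ K ] ∃[ N ] ∀ (n ℓ m : ℕ) → N ≤ n → ℓ ≡ ⌊log₂ n ⌋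
      → 10 * ℓ * m ≤ n → n < 10 * ℓ * suc m
      → ∃ λ (L : List (Vec (Point n) m))
          → Unique L
          × All (λ ys → VAll.All (λ y → weight y ≡ n ∸ ℓ) ys × Shattered ys) L
          × n * ((n C (n ∸ ℓ)) ^ m) ≤ n * length L + K * ((n C (n ∸ ℓ)) ^ m)
lemma8p4 = 4 , 0 , λ where
  n zero    m _ _     _      ()
  n (suc ℓ) m _ ℓ≡log 10ℓm≤n _ →
      tuplesWithPrivateZeros n (suc ℓ) m
    , tuplesWithPrivateZeros-unique n (suc ℓ) m
    , tuplesWithPrivateZeros-shattered n (suc ℓ) m
    , tuplesWithPrivateZeros-many n (suc ℓ) m ℓ≡log 10ℓm≤n
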